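{- Let $F_{\underline{231}}(x,t)=\sum_{n\ge0}\sum_{\pi\in\mathbf S_n(132,\underline{123})}x^nt^{\mathrm{occ}_{231}(\pi)}$. Then $F_{\underline{231}}(x,t)=1+G\,(x+x^2G)$, where $G=\dfrac{1-x-\sqrt{1+x^2-2x-4x^2t}}{2x^2t}$.
   Context: $\mathbf S_n(132,\underline{123})$ is the set of $\pi\in\mathbf S_n$ with no subsequence order-isomorphic to $132$ and no three consecutive entries order-isomorphic to $123$. $\mathrm{occ}_{231}(\pi)$ is the number of indices $i$ such that $\pi_i\pi_{i+1}\pi_{i+2}$ is order-isomorphic to $231$. -}

module Defs where

open import Data.Nat as ℕ using (ℕ; zero; suc; _<_; _<?_)
open import Data.Integer as ℤ using (ℤ; +_; 0ℤ; 1ℤ)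
open import Data.Bool using (Bool; true; false; _∧_; if_then_else_)
open import Data.List using (List; []; _∷_; _++_; upTo; length)
open import Data.List.Relation.Binary.Sublist.Propositional using (_⊆_)
open import Data.List.Relation.Binary.Permutation.Propositional using (_↭_)
open import Data.List.Relation.Unary.Unique.Propositional using (Unique)
open import Data.List.Membership.Propositional using (_∈_)
open import Data.Product using (Σ; ∃; ∃-syntax; _×_)
open import Relation.Nullary using (¬_)
open import Relation.Nullary.Decidable using (⌊_⌋)
open import Relation.Binary.PropositionalEquality using (_≡_)
open import Function.Bundles using (_⇔_)

-- Permutations of length n are lists that are rearrangements of
-- [0, 1, ..., n-1]  (values shifted by one; order-isomorphism unaffected).

IsPermOf : ℕ → List ℕ → Set
IsPermOf n π = π ↭ upTo n

Contains132 : List ℕ → Set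
Contains132 π = ∃[ a ] ∃[ b ] ∃[ c ] ((a ∷ b ∷ c ∷ []) ⊆ π × a < c × c < b)

ContainsConsec123 : List ℕ → Set
ContainsConsec123 π =
  ∃[ xs ] ∃[ ys ] ∃[ a ] ∃[ b ] ∃[ c ]
    (π ≡ xs ++ (a ∷ b ∷ c ∷ ys) × a < b × b < c)

InS : ℕ → List ℕ → Set
InS n π = IsPermOf n π × ¬ Contains132 π × ¬ ContainsConsec123 π

occ231 : List ℕ → ℕ
occ231 (a ∷ b ∷ c ∷ rest) =
  (if ⌊ c <? a ⌋ ∧ ⌊ a <? b ⌋ then 1 else 0) ℕ.+ occ231 (b ∷ c ∷ rest)
occ231 _ = 0

HasCount : ℕ → ℕ → ℤ → Set
HasCount n k m =
  Σ (List (List ℕ)) λ L →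
    Unique L × (∀ π → (π ∈ L) ⇔ (InS n π × occ231 π ≡ k)) × + length L ≡ m

-- Formal power series in x, t with integer coefficients:
-- A n k = coefficient of x^n t^k.

PS : Set
PS = ℕ → ℕ → ℤ

sumTo : ℕ → (ℕ → ℤ) → ℤ
sumTo zero f = f 0
sumTo (suc n) f = sumTo n f ℤ.+ f (suc n)

infixl 7 _⋆_
infixl 6 _⊕_ _⊖_

_⋆_ : PS → PS → PS
(A ⋆ B) n k = sumTo n λ i → sumTo k λ j → A i j ℤ.* B (n ℕ.∸ i) (k ℕ.∸ j)

_⊕_ : PS → PS → PS
(A ⊕ B) n k = A n k ℤ.+ B n k

_⊖_ : PS → PS → PS
(A ⊖ B) n k = A n k ℤ.- B n k

mono : ℤ → ℕ → ℕ → PS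
mono c a b n k with n ℕ.≟ a | k ℕ.≟ b
... | Relation.Nullary.yes _ | Relation.Nullary.yes _ = c
... | _ | _ = 0ℤ

𝟙 𝕩 : PS
𝟙 = mono 1ℤ 0 0
𝕩 = mono 1ℤ 1 0

Disc : PS
Disc = mono 1ℤ 0 0 ⊕ mono 1ℤ 2 0 ⊕ mono (ℤ.- (+ 2)) 1 0 ⊕ mono (ℤ.- (+ 4)) 2 1

_≗ₚ_ : PS → PS → Set
A ≗ₚ B = ∀ n k → A n k ≡ B n k

module Submission where

-- Write a permutation π avoiding 132 and consecutive 123 as α m β around
-- its maximum m.  Avoiding 132 puts every value of α above every value of β,
-- so α and β are such permutations of intervals again; π has no consecutive
-- 123 iff α and β have none and α does not end with an ascent; and the
-- consecutive 231's of π are those of α, those of β and one more at the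
-- junction when both sides are nonempty.  If F counts these permutations and
-- N those not ending with an ascent (by size x and 231's t), this gives
--     F = 1 + xF + x(N − 1) + xt(N − 1)(F − 1),   N = 1 + xN + xt(N − 1)².
-- Algebraically, the hypotheses give S = 1 − x − 2x²tG and, comparing with
-- S² = 1 − 2x + x² − 4x²t, G = 1 + xG + x²tG²; then F = 1 + G(x + x²G) and
-- N = 1 + xG satisfy the two recurrences.

open import Defs
open import Data.Nat as ℕ using (ℕ; zero; suc; _≤_; _<_; z≤n; s≤s; _∸_; _<?_)
import Data.Nat.Properties as ℕP
open import Data.Nat.Induction using (<-rec)
open import Data.Integer as ℤ using (ℤ; +_; 0ℤ; 1ℤ)
import Data.Integer.Properties as ℤP
open import Data.Integer.Tactic.RingSolver using (solve-∀)
open import Data.Bool using (_∧_; if_then_else_)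
open import Data.List using (List; []; _∷_; _++_; applyUpTo; length; map; cartesianProduct)
import Data.List.Properties as ListP
open import Data.List.Extrema.Nat using (min; min≤⊤; min≤xs; v<min⁺; argmin-sel)
open import Data.List.Membership.Propositional using (_∈_; _∉_)
import Data.List.Membership.Propositional.Properties as ∈P
open import Data.List.Membership.Propositional.Properties.WithK using (unique∧set⇒bag)
open import Data.List.Relation.Unary.Any using (here; there)
open import Data.List.Relation.Unary.All as All using ([]; _∷_)
import Data.List.Relation.Unary.All.Properties as AllP
open import Data.List.Relation.Unary.AllPairs using ([]; _∷_)
open import Data.List.Relation.Unary.Unique.Propositional using (Unique)
import Data.List.Relation.Unary.Unique.Propositional.Properties as UniqueP
open import Data.List.Relation.Binary.Permutation.Propositional using (_↭_; ↭-refl; ↭-sym; ↭⇒↭ₛ)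
import Data.List.Relation.Binary.Permutation.Propositional.Properties as ↭P
import Data.List.Relation.Binary.Permutation.Setoid.Properties as ↭ₛP
open import Data.List.Relation.Binary.BagAndSetEquality using (∼bag⇒↭)
open import Data.List.Relation.Binary.Sublist.Propositional using (_⊆_; []; _∷_; _∷ʳ_; from∈)
  renaming (lookup to ⊆-lookup)
import Data.List.Relation.Binary.Sublist.Propositional.Properties as ⊆P
open import Data.Product using (∃; ∃₂; _×_; _,_; proj₁; proj₂)
open import Data.Sum using (_⊎_; inj₁; inj₂; [_,_]′) renaming (map to ⊎-map)
open import Data.Empty using (⊥; ⊥-elim)
open import Data.Unit using (⊤; tt)
open import Relation.Nullary using (¬_; yes; no; contradiction)
open import Relation.Nullary.Decidable using (⌊_⌋)
open import Relation.Binary using (tri<; tri≈; tri>)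
open import Relation.Binary.Bundles using (Setoid)
import Relation.Binary.Reasoning.Setoid
open import Relation.Binary.PropositionalEquality
open import Function using (_∘_; case_of_)
open import Function.Bundles using (_⇔_; mk⇔; Equivalence)

module PowerSeries where
  open import Data.Integer using (_+_; _*_; _-_; -_)

  infix  4 _≐_
  infixr 8 x·_ t·_

  -- coefficientwise equality as a record, so that Agda can infer the two
  -- series from a proof of it
  record _≐_ (A B : PS) : Set where
    constructor coeffwise
    field coeff : A ≗ₚ B
  open _≐_ public

  ≐-setoid : Setoid _ _
  ≐-setoid = record
    { Carrier = PS ; _≈_ = _≐_
    ; isEquivalence = record
      { refl  = coeffwise λ _ _ → refl
      ; sym   = λ e → coeffwise λ n k → sym (coeff e n k)
      ; trans = λ e f → coeffwise λ n k → trans (coeff e n k) (coeff f n k) } }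

  module ≐-Reasoning = Relation.Binary.Reasoning.Setoid ≐-setoid
  open Setoid ≐-setoid public using () renaming (refl to ≐-refl; trans to ≐-trans)

  unit : PS
  unit zero zero = 1ℤ
  unit _    _    = 0ℤ

  x·_ : PS → PS
  (x· A) zero    k = 0ℤ
  (x· A) (suc n) k = A n k

  t·_ : PS → PS
  (t· A) n zero    = 0ℤ
  (t· A) n (suc k) = A n k

  scale : ℤ → PS → PS
  scale c A n k = c * A n k

  ⊕-cong : ∀ {A A′ B B′} → A ≐ A′ → B ≐ B′ → A ⊕ B ≐ A′ ⊕ B′
  ⊕-cong e f = coeffwise λ n k → cong₂ _+_ (coeff e n k) (coeff f n k)

  ⊖-cong : ∀ {A A′ B B′} → A ≐ A′ → B ≐ B′ → A ⊖ B ≐ A′ ⊖ B′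
  ⊖-cong e f = coeffwise λ n k → cong₂ _-_ (coeff e n k) (coeff f n k)

  x·-cong : ∀ {A B} → A ≐ B → x· A ≐ x· B
  x·-cong e = coeffwise λ where
    zero    k → refl
    (suc n) k → coeff e n k

  t·-cong : ∀ {A B} → A ≐ B → t· A ≐ t· B
  t·-cong e = coeffwise λ where
    n zero    → refl
    n (suc k) → coeff e n k

  scale-cong : ∀ c {A B} → A ≐ B → scale c A ≐ scale c B
  scale-cong c e = coeffwise λ n k → cong (c *_) (coeff e n k)

  t·x· : ∀ A → t· x· A ≐ x· t· A
  t·x· A = coeffwise λ where
    zero    zero    → refl
    zero    (suc k) → refl
    (suc n) zero    → refl
    (suc n) (suc k) → refl

  t·-⊕ : ∀ A B → t· (A ⊕ B) ≐ t· A ⊕ t· B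
  t·-⊕ A B = coeffwise λ where
    n zero    → refl
    n (suc k) → refl

  sumTo-cong : ∀ n {f g : ℕ → ℤ} → (∀ i → i ≤ n → f i ≡ g i) → sumTo n f ≡ sumTo n g
  sumTo-cong zero    e = e 0 z≤n
  sumTo-cong (suc n) e = cong₂ _+_ (sumTo-cong n (λ i i≤n → e i (ℕP.m≤n⇒m≤1+n i≤n))) (e (suc n) ℕP.≤-refl)

  sumTo-head : ∀ n (f : ℕ → ℤ) → sumTo (suc n) f ≡ f 0 + sumTo n (f ∘ suc)
  sumTo-head zero    f = refl
  sumTo-head (suc n) f = trans (cong (_+ f (suc (suc n))) (sumTo-head n f)) (ℤP.+-assoc (f 0) _ _)

  sumTo-reverse : ∀ n (f : ℕ → ℤ) → sumTo n f ≡ sumTo n (λ i → f (n ∸ i))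
  sumTo-reverse zero    f = refl
  sumTo-reverse (suc n) f = begin
    sumTo n f + f (suc n)                   ≡⟨ cong (_+ f (suc n)) (sumTo-reverse n f) ⟩
    sumTo n (λ i → f (n ∸ i)) + f (suc n)   ≡⟨ ℤP.+-comm _ (f (suc n)) ⟩
    f (suc n) + sumTo n (λ i → f (n ∸ i))   ≡⟨ sumTo-head n (λ i → f (suc n ∸ i)) ⟨
    sumTo (suc n) (λ i → f (suc n ∸ i))     ∎
    where open ≡-Reasoning

  sumTo-+ : ∀ n (f g : ℕ → ℤ) → sumTo n (λ i → f i + g i) ≡ sumTo n f + sumTo n g
  sumTo-+ zero    f g = refl
  sumTo-+ (suc n) f g =
    trans (cong (_+ (f (suc n) + g (suc n))) (sumTo-+ n f g)) (interchange (sumTo n f) (sumTo n g) (f (suc n)) (g (suc n)))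
    where
    interchange : ∀ a b c d → (a + b) + (c + d) ≡ (a + c) + (b + d)
    interchange = solve-∀

  sumTo-* : ∀ n c (f : ℕ → ℤ) → sumTo n (λ i → c * f i) ≡ c * sumTo n f
  sumTo-* zero    c f = refl
  sumTo-* (suc n) c f = trans (cong (_+ c * f (suc n)) (sumTo-* n c f)) (sym (ℤP.*-distribˡ-+ c _ _))

  sumTo-zero : ∀ n (f : ℕ → ℤ) → (∀ i → f i ≡ 0ℤ) → sumTo n f ≡ 0ℤ
  sumTo-zero zero    f z = z 0
  sumTo-zero (suc n) f z = cong₂ _+_ (sumTo-zero n f z) (z (suc n))

  ⋆-cong : ∀ {A A′ B B′} → A ≐ A′ → B ≐ B′ → A ⋆ B ≐ A′ ⋆ B′
  ⋆-cong e f = coeffwise λ n k →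
    sumTo-cong n λ i _ → sumTo-cong k λ j _ → cong₂ _*_ (coeff e i j) (coeff f (n ∸ i) (k ∸ j))

  ⋆-comm : ∀ A B → A ⋆ B ≐ B ⋆ A
  ⋆-comm A B = coeffwise reversed
    where
    reversed : (A ⋆ B) ≗ₚ (B ⋆ A)
    reversed n k = begin
      sumTo n (λ i → sumTo k λ j → A i j * B (n ∸ i) (k ∸ j))
        ≡⟨ sumTo-reverse n _ ⟩
      sumTo n (λ i → sumTo k λ j → A (n ∸ i) j * B (n ∸ (n ∸ i)) (k ∸ j))
        ≡⟨ sumTo-cong n (λ i i≤n → trans (sumTo-reverse k _) (sumTo-cong k λ j j≤k →
             trans (ℤP.*-comm (A (n ∸ i) (k ∸ j)) _)
                   (cong₂ (λ u v → B u v * A (n ∸ i) (k ∸ j))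
                          (ℕP.m∸[m∸n]≡n i≤n) (ℕP.m∸[m∸n]≡n j≤k)))) ⟩
      sumTo n (λ i → sumTo k λ j → B i j * A (n ∸ i) (k ∸ j)) ∎
      where open ≡-Reasoning

  ⋆-distribʳ-⊕ : ∀ A B C → (A ⊕ B) ⋆ C ≐ A ⋆ C ⊕ B ⋆ C
  ⋆-distribʳ-⊕ A B C = coeffwise λ n k → trans
    (sumTo-cong n λ i _ → trans (sumTo-cong k λ j _ → ℤP.*-distribʳ-+ (C (n ∸ i) (k ∸ j)) (A i j) (B i j))
                                (sumTo-+ k _ _))
    (sumTo-+ n _ _)

  ⋆-scale : ∀ c A B → scale c A ⋆ B ≐ scale c (A ⋆ B)
  ⋆-scale c A B = coeffwise λ n k → trans
    (sumTo-cong n λ i _ → trans (sumTo-cong k λ j _ → ℤP.*-assoc c (A i j) (B (n ∸ i) (k ∸ j)))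
                                (sumTo-* k c _))
    (sumTo-* n c _)

  ⋆-distribʳ-⊖ : ∀ A B C → (A ⊖ B) ⋆ C ≐ A ⋆ C ⊖ B ⋆ C
  ⋆-distribʳ-⊖ A B C = begin
    (A ⊖ B) ⋆ C                   ≈⟨ ⋆-cong (⊖-as-⊕ A B) (≐-refl {C}) ⟩
    (A ⊕ scale (- 1ℤ) B) ⋆ C      ≈⟨ ⋆-distribʳ-⊕ A _ C ⟩
    A ⋆ C ⊕ scale (- 1ℤ) B ⋆ C    ≈⟨ ⊕-cong (≐-refl {A ⋆ C}) (⋆-scale (- 1ℤ) B C) ⟩
    A ⋆ C ⊕ scale (- 1ℤ) (B ⋆ C)  ≈⟨ ⊖-as-⊕ (A ⋆ C) (B ⋆ C) ⟨
    A ⋆ C ⊖ B ⋆ C                 ∎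
    where
    open ≐-Reasoning
    ⊖-as-⊕ : ∀ P Q → P ⊖ Q ≐ P ⊕ scale (- 1ℤ) Q
    ⊖-as-⊕ P Q = coeffwise λ n k → cong (λ z → P n k + z) (sym (ℤP.-1*i≡-i (Q n k)))

  ⋆-x· : ∀ A B → x· A ⋆ B ≐ x· (A ⋆ B)
  ⋆-x· A B = coeffwise shifted
    where
    shifted : (x· A ⋆ B) ≗ₚ (x· (A ⋆ B))
    shifted zero    k = sumTo-zero k _ λ _ → refl
    shifted (suc n) k = begin
      sumTo (suc n) (λ i → sumTo k λ j → (x· A) i j * B (suc n ∸ i) (k ∸ j))
        ≡⟨ sumTo-head n _ ⟩
      sumTo k (λ j → 0ℤ) + (A ⋆ B) n k
        ≡⟨ cong (_+ (A ⋆ B) n k) (sumTo-zero k _ λ _ → refl) ⟩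
      0ℤ + (A ⋆ B) n k
        ≡⟨ ℤP.+-identityˡ _ ⟩
      (A ⋆ B) n k ∎
      where open ≡-Reasoning

  ⋆-x·ʳ : ∀ A B → A ⋆ x· B ≐ x· (A ⋆ B)
  ⋆-x·ʳ A B = ≐-trans (⋆-comm A (x· B)) (≐-trans (⋆-x· B A) (x·-cong (⋆-comm B A)))

  ⋆-t· : ∀ A B → t· A ⋆ B ≐ t· (A ⋆ B)
  ⋆-t· A B = coeffwise λ where
    n zero    → sumTo-zero n _ λ _ → refl
    n (suc k) → sumTo-cong n λ i _ → trans (sumTo-head k _) (ℤP.+-identityˡ _)

  ⋆-unit : ∀ B → unit ⋆ B ≐ B
  ⋆-unit B = coeffwise corner-only
    where
    corner-only : (unit ⋆ B) ≗ₚ B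
    corner-only n k = trans (sumTo-cong n λ i _ → sumTo-cong k λ j _ → term i j) (diagonal n k)
      where
      corner : ℕ → ℕ → ℤ
      corner zero zero = B n k
      corner _    _    = 0ℤ
      term : ∀ i j → unit i j * B (n ∸ i) (k ∸ j) ≡ corner i j
      term zero    zero    = ℤP.*-identityˡ _
      term zero    (suc j) = ℤP.*-zeroˡ (B n (k ∸ suc j))
      term (suc i) j       = ℤP.*-zeroˡ (B (n ∸ suc i) (k ∸ j))
      diagonal : ∀ n′ k′ → sumTo n′ (λ i → sumTo k′ (corner i)) ≡ B n k
      diagonal zero    zero    = refl
      diagonal zero    (suc k′) = trans (cong (_+ 0ℤ) (diagonal zero k′)) (ℤP.+-identityʳ _)
      diagonal (suc n′) k′ = trans (cong (_+ sumTo k′ (λ _ → 0ℤ)) (diagonal n′ k′))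
                                   (trans (cong (λ z → B n k + z) (sumTo-zero k′ (λ _ → 0ℤ) λ _ → refl))
                                          (ℤP.+-identityʳ _))

open PowerSeries using (_≐_; coeffwise)

module Equations (S G : PS) (quadratic : S ⋆ S ≐ Disc)
                 (linear : mono (+ 2) 2 1 ⋆ G ≐ 𝟙 ⊖ 𝕩 ⊖ S) where
  open PowerSeries
  open import Data.Integer using (_+_; _*_; _-_; -_)

  𝟙≐unit : 𝟙 ≐ unit
  𝟙≐unit = coeffwise λ where
    zero    zero    → refl
    zero    (suc k) → refl
    (suc n) k       → refl

  𝕩≐x·unit : 𝕩 ≐ x· unit
  𝕩≐x·unit = coeffwise λ where
    zero          k       → refl
    (suc zero)    zero    → refl
    (suc zero)    (suc k) → refl
    (suc (suc n)) k       → refl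

  x²≐x·x·unit : mono 1ℤ 2 0 ≐ x· x· unit
  x²≐x·x·unit = coeffwise λ where
    zero                k       → refl
    (suc zero)          k       → refl
    (suc (suc zero))    zero    → refl
    (suc (suc zero))    (suc k) → refl
    (suc (suc (suc n))) k       → refl

  2x²t≐ : mono (+ 2) 2 1 ≐ scale (+ 2) (x· x· t· unit)
  2x²t≐ = coeffwise λ where
    zero                k             → refl
    (suc zero)          k             → refl
    (suc (suc zero))    zero          → refl
    (suc (suc zero))    (suc zero)    → refl
    (suc (suc zero))    (suc (suc k)) → refl
    (suc (suc (suc n))) zero          → refl
    (suc (suc (suc n))) (suc k)       → refl

  Disc-x²t : ∀ n k → Disc (suc (suc n)) (suc k) ≡ - (+ 4) * unit n k
  Disc-x²t zero    zero    = refl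
  Disc-x²t zero    (suc k) = refl
  Disc-x²t (suc n) k       = refl

  unit-t : ∀ n k → unit n (suc k) ≡ 0ℤ
  unit-t zero    k = refl
  unit-t (suc n) k = refl

  x·x·t·-⋆ : ∀ A B → x· x· t· A ⋆ B ≐ x· x· t· (A ⋆ B)
  x·x·t·-⋆ A B = ≐-trans (⋆-x· (x· t· A) B) (x·-cong (≐-trans (⋆-x· (t· A) B) (x·-cong (⋆-t· A B))))

  𝕩-⋆ : ∀ B → 𝕩 ⋆ B ≐ x· B
  𝕩-⋆ B = ≐-trans (⋆-cong 𝕩≐x·unit (≐-refl {B})) (≐-trans (⋆-x· unit B) (x·-cong (⋆-unit B)))

  x²-⋆ : ∀ B → mono 1ℤ 2 0 ⋆ B ≐ x· x· B
  x²-⋆ B = ≐-trans (⋆-cong x²≐x·x·unit (≐-refl {B}))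
           (≐-trans (⋆-x· (x· unit) B) (x·-cong (≐-trans (⋆-x· unit B) (x·-cong (⋆-unit B)))))

  2x²t-⋆ : ∀ B → mono (+ 2) 2 1 ⋆ B ≐ scale (+ 2) (x· x· t· B)
  2x²t-⋆ B = ≐-trans (⋆-cong 2x²t≐ (≐-refl {B}))
             (≐-trans (⋆-scale (+ 2) (x· x· t· unit) B)
             (scale-cong (+ 2) (≐-trans (x·x·t·-⋆ unit B) (x·-cong (x·-cong (t·-cong (⋆-unit B)))))))

  S-explicit : S ≐ (unit ⊖ x· unit) ⊖ scale (+ 2) (x· x· t· G)
  S-explicit = coeffwise λ n k →
    trans (subtract-twice (S n k) (𝟙 n k - 𝕩 n k))
          (cong₂ _-_ (cong₂ _-_ (coeff 𝟙≐unit n k) (coeff 𝕩≐x·unit n k))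
                     (trans (sym (coeff linear n k)) (coeff (2x²t-⋆ G) n k)))
    where
    subtract-twice : ∀ s p → s ≡ p - (p - s)
    subtract-twice = solve-∀

  S-⋆ : ∀ B → S ⋆ B ≐ (B ⊖ x· B) ⊖ scale (+ 2) (x· x· t· (G ⋆ B))
  S-⋆ B = begin
    S ⋆ B
      ≈⟨ ⋆-cong S-explicit (≐-refl {B}) ⟩
    ((unit ⊖ x· unit) ⊖ scale (+ 2) (x· x· t· G)) ⋆ B
      ≈⟨ ⋆-distribʳ-⊖ (unit ⊖ x· unit) _ B ⟩
    (unit ⊖ x· unit) ⋆ B ⊖ scale (+ 2) (x· x· t· G) ⋆ B
      ≈⟨ ⊖-cong (⋆-distribʳ-⊖ unit (x· unit) B) (⋆-scale (+ 2) (x· x· t· G) B) ⟩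
    (unit ⋆ B ⊖ x· unit ⋆ B) ⊖ scale (+ 2) (x· x· t· G ⋆ B)
      ≈⟨ ⊖-cong (⊖-cong (⋆-unit B) (≐-trans (⋆-x· unit B) (x·-cong (⋆-unit B))))
                (scale-cong (+ 2) (x·x·t·-⋆ G B)) ⟩
    (B ⊖ x· B) ⊖ scale (+ 2) (x· x· t· (G ⋆ B)) ∎
    where open ≐-Reasoning

  -- the key algebraic fact:  G = 1 + xG + x²t G², read off from the
  -- coefficient of x^(n+2) t^(k+1) in  S² = 1 − 2x + x² − 4x²t
  G-recurrence : G ≐ unit ⊕ x· G ⊕ x· x· t· (G ⋆ G)
  G-recurrence = coeffwise λ n k → ℤP.*-cancelˡ-≡ (- (+ 4)) _ _ (scaled n k)
    where
    module _ (n k : ℕ) where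
      g s p : ℤ
      g = G n k
      s = (x· G) n k
      p = (x· x· t· (G ⋆ G)) n k

      S-corner : S (suc (suc n)) (suc k) ≡ (0ℤ - 0ℤ) - + 2 * g
      S-corner = coeff S-explicit (suc (suc n)) (suc k)

      S-edge : S (suc n) (suc k) ≡ (0ℤ - 0ℤ) - + 2 * s
      S-edge = trans (coeff S-explicit (suc n) (suc k))
                     (cong₂ (λ u v → (0ℤ - u) - + 2 * v) (unit-t n k) (sym (coeff (t·x· G) n (suc k))))

      GS : (G ⋆ S) n k ≡ (g - s) - + 2 * p
      GS = trans (coeff (⋆-comm G S) n k) (coeff (S-⋆ G) n k)

      coefficient : ((0ℤ - 0ℤ) - + 2 * g) - ((0ℤ - 0ℤ) - + 2 * s) - + 2 * ((g - s) - + 2 * p)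
                    ≡ - (+ 4) * unit n k
      coefficient = begin
        _ ≡⟨ cong₂ (λ u v → u - + 2 * v) (cong₂ _-_ S-corner S-edge) GS ⟨
        (S (suc (suc n)) (suc k) - S (suc n) (suc k)) - + 2 * (G ⋆ S) n k
          ≡⟨ coeff (S-⋆ S) (suc (suc n)) (suc k) ⟨
        (S ⋆ S) (suc (suc n)) (suc k) ≡⟨ coeff quadratic (suc (suc n)) (suc k) ⟩
        Disc (suc (suc n)) (suc k)    ≡⟨ Disc-x²t n k ⟩
        - (+ 4) * unit n k ∎
        where open ≡-Reasoning

      scaled : - (+ 4) * g ≡ - (+ 4) * (unit n k + s + p)
      scaled = begin
        - (+ 4) * g
          ≡⟨ expand g s p ⟩
        ((0ℤ - 0ℤ) - + 2 * g) - ((0ℤ - 0ℤ) - + 2 * s) - + 2 * ((g - s) - + 2 * p) + - (+ 4) * (s + p)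
          ≡⟨ cong (_+ - (+ 4) * (s + p)) coefficient ⟩
        - (+ 4) * unit n k + - (+ 4) * (s + p)
          ≡⟨ collect (unit n k) s p ⟩
        - (+ 4) * (unit n k + s + p) ∎
        where
        open ≡-Reasoning
        expand : ∀ g s p → - (+ 4) * g ≡
          ((0ℤ - 0ℤ) - + 2 * g) - ((0ℤ - 0ℤ) - + 2 * s) - + 2 * ((g - s) - + 2 * p) + - (+ 4) * (s + p)
        expand = solve-∀
        collect : ∀ u s p → - (+ 4) * u + - (+ 4) * (s + p) ≡ - (+ 4) * (u + s + p)
        collect = solve-∀

  -- the series of the theorem, and N = 1 + xG, which will count the
  -- permutations not ending with an ascent
  F N : PS
  F = 𝟙 ⊕ G ⋆ (𝕩 ⊕ mono 1ℤ 2 0 ⋆ G)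
  N = unit ⊕ x· G

  F-explicit : F ≐ unit ⊕ x· G ⊕ x· x· (G ⋆ G)
  F-explicit = coeffwise λ n k →
    trans (coeff (⊕-cong 𝟙≐unit product) n k) (sym (ℤP.+-assoc (unit n k) _ _))
    where
    product : G ⋆ (𝕩 ⊕ mono 1ℤ 2 0 ⋆ G) ≐ x· G ⊕ x· x· (G ⋆ G)
    product = begin
      G ⋆ (𝕩 ⊕ mono 1ℤ 2 0 ⋆ G)       ≈⟨ ⋆-comm G (𝕩 ⊕ mono 1ℤ 2 0 ⋆ G) ⟩
      (𝕩 ⊕ mono 1ℤ 2 0 ⋆ G) ⋆ G       ≈⟨ ⋆-distribʳ-⊕ 𝕩 (mono 1ℤ 2 0 ⋆ G) G ⟩
      𝕩 ⋆ G ⊕ (mono 1ℤ 2 0 ⋆ G) ⋆ G   ≈⟨ ⊕-cong (𝕩-⋆ G) (⋆-cong (x²-⋆ G) (≐-refl {G})) ⟩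
      x· G ⊕ x· x· G ⋆ G
        ≈⟨ ⊕-cong (≐-refl {x· G}) (≐-trans (⋆-x· (x· G) G) (x·-cong (⋆-x· G G))) ⟩
      x· G ⊕ x· x· (G ⋆ G)            ∎
      where open ≐-Reasoning

  F-start : ∀ k → F 0 k ≡ unit 0 k
  F-start k = trans (coeff F-explicit 0 k) (trans (ℤP.+-identityʳ _) (ℤP.+-identityʳ _))

  N-start : ∀ k → N 0 k ≡ unit 0 k
  N-start k = ℤP.+-identityʳ _

  x·G-squared : x· G ⋆ x· G ≐ x· x· (G ⋆ G)
  x·G-squared = ≐-trans (⋆-x· G (x· G)) (x·-cong (⋆-x·ʳ G G))

  t·x·x· : ∀ A → t· x· x· A ≐ x· x· t· A
  t·x·x· A = ≐-trans (t·x· (x· A)) (x·-cong (t·x· A))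

  N-1 : N ⊖ unit ≐ x· G
  N-1 = coeffwise λ n k → cancel (unit n k) ((x· G) n k)
    where
    cancel : ∀ a b → (a + b) - a ≡ b
    cancel = solve-∀

  -- coefficientwise form of  N = 1 + xN + xt (N − 1)²
  N-recurrence : ∀ n k → N (suc n) k ≡ N n k + (t· ((N ⊖ unit) ⋆ (N ⊖ unit))) n k
  N-recurrence n k = begin
    0ℤ + G n k                                 ≡⟨ ℤP.+-identityˡ _ ⟩
    G n k                                      ≡⟨ coeff G-recurrence n k ⟩
    N n k + (x· x· t· (G ⋆ G)) n k             ≡⟨ cong (λ z → N n k + z) (coeff squared n k) ⟨
    N n k + (t· (x· G ⋆ x· G)) n k
      ≡⟨ cong (λ z → N n k + z) (coeff (t·-cong (⋆-cong N-1 N-1)) n k) ⟨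
    N n k + (t· ((N ⊖ unit) ⋆ (N ⊖ unit))) n k ∎
    where
    open ≡-Reasoning
    squared : t· (x· G ⋆ x· G) ≐ x· x· t· (G ⋆ G)
    squared = ≐-trans (t·-cong x·G-squared) (t·x·x· (G ⋆ G))

  G²-recurrence : G ⋆ G ≐ G ⊕ x· (G ⋆ G) ⊕ x· x· t· ((G ⋆ G) ⋆ G)
  G²-recurrence = begin
    G ⋆ G
      ≈⟨ ⋆-cong G-recurrence (≐-refl {G}) ⟩
    (unit ⊕ x· G ⊕ x· x· t· (G ⋆ G)) ⋆ G
      ≈⟨ ⋆-distribʳ-⊕ (unit ⊕ x· G) _ G ⟩
    (unit ⊕ x· G) ⋆ G ⊕ x· x· t· (G ⋆ G) ⋆ G
      ≈⟨ ⊕-cong (≐-trans (⋆-distribʳ-⊕ unit (x· G) G) (⊕-cong (⋆-unit G) (⋆-x· G G)))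
                (x·x·t·-⋆ (G ⋆ G) G) ⟩
    G ⊕ x· (G ⋆ G) ⊕ x· x· t· ((G ⋆ G) ⋆ G) ∎
    where open ≐-Reasoning

  F-1 : F ⊖ unit ≐ x· G ⊕ x· x· (G ⋆ G)
  F-1 = coeffwise λ n k → trans (cong (_- unit n k) (coeff F-explicit n k)) (cancel (unit n k) _ _)
    where
    cancel : ∀ a b c → ((a + b) + c) - a ≡ b + c
    cancel = solve-∀

  x·G⋆[F-1] : x· G ⋆ (F ⊖ unit) ≐ x· x· (G ⋆ G) ⊕ x· x· x· ((G ⋆ G) ⋆ G)
  x·G⋆[F-1] = begin
    x· G ⋆ (F ⊖ unit)                      ≈⟨ ⋆-comm (x· G) (F ⊖ unit) ⟩
    (F ⊖ unit) ⋆ x· G                      ≈⟨ ⋆-cong F-1 (≐-refl {x· G}) ⟩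
    (x· G ⊕ x· x· (G ⋆ G)) ⋆ x· G          ≈⟨ ⋆-distribʳ-⊕ (x· G) (x· x· (G ⋆ G)) (x· G) ⟩
    x· G ⋆ x· G ⊕ x· x· (G ⋆ G) ⋆ x· G     ≈⟨ ⊕-cong x·G-squared shifted ⟩
    x· x· (G ⋆ G) ⊕ x· x· x· ((G ⋆ G) ⋆ G) ∎
    where
    open ≐-Reasoning
    shifted : x· x· (G ⋆ G) ⋆ x· G ≐ x· x· x· ((G ⋆ G) ⋆ G)
    shifted = ≐-trans (⋆-x· (x· (G ⋆ G)) (x· G)) (x·-cong (≐-trans (⋆-x· (G ⋆ G) (x· G))
                (x·-cong (⋆-x·ʳ (G ⋆ G) G))))

  -- coefficientwise form of  F = 1 + xF + x(N − 1) + xt (N − 1)(F − 1)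
  F-recurrence : ∀ n k → F (suc n) k ≡ F n k + (N ⊖ unit) n k + (t· ((N ⊖ unit) ⋆ (F ⊖ unit))) n k
  F-recurrence n k = begin
    F (suc n) k
      ≡⟨ coeff F-explicit (suc n) k ⟩
    (0ℤ + G n k) + (x· (G ⋆ G)) n k
      ≡⟨ cong₂ (λ u v → (0ℤ + u) + v) (coeff G-recurrence n k) (coeff (x·-cong G²-recurrence) n k) ⟩
    (0ℤ + (u + s + p)) + (x· (G ⊕ x· (G ⋆ G) ⊕ x· x· t· ((G ⋆ G) ⋆ G))) n k
      ≡⟨ cong (λ v → (0ℤ + (u + s + p)) + v) (x·-⊕ n) ⟩
    (0ℤ + (u + s + p)) + (s + q + r)
      ≡⟨ regroup u s p q r ⟩
    (u + s + q) + s + (p + r)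
      ≡⟨ cong₂ (λ a b → a + s + b) (coeff F-explicit n k) tail ⟨
    F n k + s + (t· (x· G ⋆ (F ⊖ unit))) n k
      ≡⟨ cong₂ (λ a b → F n k + a + b) (coeff N-1 n k)
               (coeff (t·-cong (⋆-cong N-1 (≐-refl {F ⊖ unit}))) n k) ⟨
    F n k + (N ⊖ unit) n k + (t· ((N ⊖ unit) ⋆ (F ⊖ unit))) n k ∎
    where
    open ≡-Reasoning
    u s p q r : ℤ
    u = unit n k
    s = (x· G) n k
    p = (x· x· t· (G ⋆ G)) n k
    q = (x· x· (G ⋆ G)) n k
    r = (x· x· x· t· ((G ⋆ G) ⋆ G)) n k
    x·-⊕ : ∀ n → (x· (G ⊕ x· (G ⋆ G) ⊕ x· x· t· ((G ⋆ G) ⋆ G))) n k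
                 ≡ (x· G) n k + (x· x· (G ⋆ G)) n k + (x· x· x· t· ((G ⋆ G) ⋆ G)) n k
    x·-⊕ zero    = refl
    x·-⊕ (suc n) = refl
    regroup : ∀ u s p q r → (0ℤ + (u + s + p)) + (s + q + r) ≡ (u + s + q) + s + (p + r)
    regroup = solve-∀
    tail : (t· (x· G ⋆ (F ⊖ unit))) n k ≡ p + r
    tail = trans (coeff (≐-trans (t·-cong x·G⋆[F-1]) (t·-⊕ _ _)) n k)
                 (cong₂ _+_ (coeff (t·x·x· (G ⋆ G)) n k)
                            (coeff (≐-trans (t·x· (x· x· _)) (x·-cong (t·x·x· ((G ⋆ G) ⋆ G)))) n k))

module Enumeration where
  open import Data.Integer using (_+_; _*_)
  open Equivalence using (to; from)

  -- an explicit duplicate-free list of exactly the objects satisfying P,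
  -- of length c; this is the shape of HasCount
  record Enumeration {X : Set} (P : X → Set) (c : ℤ) : Set where
    constructor enumeration
    field
      elements : List X
      distinct : Unique elements
      exact    : ∀ x → x ∈ elements ⇔ P x
      count    : + length elements ≡ c
  open Enumeration public

  private
    variable
      X Y : Set

  enum-resp : ∀ {P Q : X → Set} {a b} → (∀ x → P x ⇔ Q x) → a ≡ b → Enumeration P a → Enumeration Q b
  enum-resp P⇔Q refl (enumeration L u e c) =
    enumeration L u (λ x → mk⇔ (to (P⇔Q x) ∘ to (e x)) (from (e x) ∘ from (P⇔Q x))) c

  enum-∅ : ∀ {P : X → Set} → (∀ x → ¬ P x) → Enumeration P 0ℤ
  enum-∅ none = enumeration [] [] (λ x → mk⇔ (λ ()) (λ p → contradiction p (none x))) refl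

  enum-single : ∀ {P : X → Set} a → (∀ x → P x ⇔ x ≡ a) → Enumeration P 1ℤ
  enum-single a only = enumeration (a ∷ []) ([] ∷ [])
    (λ x → mk⇔ (λ { (here refl) → from (only x) refl }) (λ p → here (to (only x) p))) refl

  enum-⊎ : ∀ {P Q : X → Set} {a b} → Enumeration P a → Enumeration Q b → (∀ {x} → P x → ¬ Q x) →
           Enumeration (λ x → P x ⊎ Q x) (a + b)
  enum-⊎ (enumeration L u e c) (enumeration L′ u′ e′ c′) disjoint = enumeration (L ++ L′)
    (UniqueP.++⁺ u u′ λ (x∈L , x∈L′) → disjoint (to (e _) x∈L) (to (e′ _) x∈L′))
    (λ x → mk⇔ (λ x∈ → ⊎-map (to (e x)) (to (e′ x)) (∈P.∈-++⁻ L x∈))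
               [ (λ p → ∈P.∈-++⁺ˡ (from (e x) p)) , (λ q → ∈P.∈-++⁺ʳ L (from (e′ x) q)) ]′)
    (trans (cong +_ (ListP.length-++ L)) (trans (ℤP.pos-+ (length L) (length L′)) (cong₂ _+_ c c′)))

  enum-image : ∀ {P : X → Set} {c} (f : X → Y) → (∀ {x y} → P x → P y → f x ≡ f y → x ≡ y) →
               Enumeration P c → Enumeration (λ y → ∃ λ x → P x × y ≡ f x) c
  enum-image f injective (enumeration L u e c) = enumeration (map f L)
    (distinct-image L u λ x∈ y∈ → injective (to (e _) x∈) (to (e _) y∈))
    (λ y → mk⇔ (λ y∈ → let x , x∈ , y≡ = ∈P.∈-map⁻ f y∈ in x , to (e x) x∈ , y≡)
               (λ { (x , p , refl) → ∈P.∈-map⁺ f (from (e x) p) }))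
    (trans (cong +_ (ListP.length-map f L)) c)
    where
    distinct-image : ∀ L → Unique L → (∀ {x y} → x ∈ L → y ∈ L → f x ≡ f y → x ≡ y) → Unique (map f L)
    distinct-image []      _          _   = []
    distinct-image (x ∷ L) (x∉ ∷ u) inj =
      AllP.map⁺ (All.tabulate λ y∈ fx≡fy → All.lookup x∉ y∈ (inj (here refl) (there y∈) fx≡fy)) ∷
      distinct-image L u λ x∈ y∈ → inj (there x∈) (there y∈)

  length-cartesianProduct : ∀ (L : List X) (L′ : List Y) →
                            length (cartesianProduct L L′) ≡ length L ℕ.* length L′
  length-cartesianProduct []      L′ = refl
  length-cartesianProduct (x ∷ L) L′ = trans (ListP.length-++ (map (x ,_) L′))
    (cong₂ ℕ._+_ (ListP.length-map (x ,_) L′) (length-cartesianProduct L L′))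

  enum-× : ∀ {P : X → Set} {Q : Y → Set} {a b} → Enumeration P a → Enumeration Q b →
           Enumeration (λ (x , y) → P x × Q y) (a * b)
  enum-× (enumeration L u e c) (enumeration L′ u′ e′ c′) = enumeration (cartesianProduct L L′)
    (UniqueP.cartesianProduct⁺ u u′)
    (λ (x , y) → mk⇔ (λ xy∈ → let x∈ , y∈ = ∈P.∈-cartesianProduct⁻ L L′ xy∈
                              in to (e x) x∈ , to (e′ y) y∈)
                     (λ (p , q) → ∈P.∈-cartesianProduct⁺ (from (e x) p) (from (e′ y) q)))
    (trans (cong +_ (length-cartesianProduct L L′))
           (trans (ℤP.pos-* (length L) (length L′)) (cong₂ _*_ c c′)))

  enum-Σ≤ : ∀ n {P : ℕ → X → Set} {c : ℕ → ℤ} →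
            (∀ i → i ≤ n → Enumeration (P i) (c i)) → (∀ {i j x} → P i x → P j x → i ≡ j) →
            Enumeration (λ x → ∃ λ i → i ≤ n × P i x) (sumTo n c)
  enum-Σ≤ zero    E indexed =
    enum-resp (λ x → mk⇔ (λ p → 0 , z≤n , p) λ { (.0 , z≤n , p) → p }) refl (E 0 z≤n)
  enum-Σ≤ (suc n) {P} E indexed =
    enum-resp union refl (enum-⊎ (enum-Σ≤ n (λ i i≤n → E i (ℕP.m≤n⇒m≤1+n i≤n)) indexed)
                                 (E (suc n) ℕP.≤-refl) last-apart)
    where
    last-apart : ∀ {x} → (∃ λ i → i ≤ n × P i x) → ¬ P (suc n) x
    last-apart (i , i≤n , p) q with indexed p q
    ... | refl = ℕP.1+n≰n i≤n
    union : ∀ x → ((∃ λ i → i ≤ n × P i x) ⊎ P (suc n) x) ⇔ (∃ λ i → i ≤ suc n × P i x)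
    union x = mk⇔ (λ { (inj₁ (i , i≤n , p)) → i , ℕP.m≤n⇒m≤1+n i≤n , p
                     ; (inj₂ p) → suc n , ℕP.≤-refl , p })
                  (λ (i , i≤1+n , p) → split-last i≤1+n p)
      where
      split-last : ∀ {i} → i ≤ suc n → P i x → (∃ λ i → i ≤ n × P i x) ⊎ P (suc n) x
      split-last {i} i≤1+n p with ℕP.m≤n⇒m<n∨m≡n i≤1+n
      ... | inj₁ i<1+n = inj₁ (i , ℕP.≤-pred i<1+n , p)
      ... | inj₂ refl  = inj₂ p

  enum-⋆ : ∀ (A B : PS) n k {P : ℕ → ℕ → X → Set} {Q : ℕ → ℕ → Y → Set} →
           (∀ {i j i′ j′ x} → P i j x → P i′ j′ x → i ≡ i′ × j ≡ j′) →
           (∀ i j → i ≤ n → j ≤ k → Enumeration (P i j) (A i j)) →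
           (∀ i j → i ≤ n → j ≤ k → Enumeration (Q i j) (B i j)) →
           Enumeration (λ (x , y) → ∃ λ i → i ≤ n × ∃ λ j → j ≤ k × P i j x × Q (n ∸ i) (k ∸ j) y)
                       ((A ⋆ B) n k)
  enum-⋆ A B n k determined EA EB =
    enum-Σ≤ n (λ i i≤n → enum-Σ≤ k (λ j j≤k → enum-× (EA i j i≤n j≤k) (EB _ _ (n∸≤ n i) (n∸≤ k j)))
                                   λ (p , _) (q , _) → proj₂ (determined p q))
              λ (_ , _ , p , _) (_ , _ , q , _) → proj₁ (determined p q)
    where n∸≤ = ℕP.m∸n≤m

module Arrangements where
  open import Data.Nat using (_+_)

  interval : ℕ → ℕ → List ℕ
  interval lo s = applyUpTo (λ i → lo + i) s

  InRange : ℕ → ℕ → ℕ → Set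
  InRange a z v = a ≤ v × v < z

  ∈-interval⁻ : ∀ {lo s v} → v ∈ interval lo s → InRange lo (lo + s) v
  ∈-interval⁻ {lo} v∈ with ∈P.∈-applyUpTo⁻ (λ i → lo + i) v∈
  ... | i , i<s , refl = ℕP.m≤m+n lo i , ℕP.+-monoʳ-< lo i<s

  ∈-interval⁺ : ∀ {lo s v} → InRange lo (lo + s) v → v ∈ interval lo s
  ∈-interval⁺ {lo} {s} {v} (lo≤v , v<lo+s) =
    subst (_∈ interval lo s) (ℕP.m+[n∸m]≡n lo≤v)
      (∈P.∈-applyUpTo⁺ (λ i → lo + i) (ℕP.+-cancelˡ-< lo (v ∸ lo) s
        (subst (_< lo + s) (sym (ℕP.m+[n∸m]≡n lo≤v)) v<lo+s)))

  interval-unique : ∀ lo s → Unique (interval lo s)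
  interval-unique lo s =
    UniqueP.applyUpTo⁺₁ (λ i → lo + i) s λ i<j _ eq → ℕP.<⇒≢ i<j (ℕP.+-cancelˡ-≡ lo _ _ eq)

  record Arrangement (a z : ℕ) (xs : List ℕ) : Set where
    constructor arrangement
    field
      unique   : Unique xs
      sound    : ∀ {v} → v ∈ xs → InRange a z v
      complete : ∀ {v} → InRange a z v → v ∈ xs
  open Arrangement public

  ↭⇒arrangement : ∀ {lo s xs} → xs ↭ interval lo s → Arrangement lo (lo + s) xs
  ↭⇒arrangement {lo} {s} p = arrangement
    (↭ₛP.Unique-resp-↭ (setoid ℕ) (↭⇒↭ₛ (↭-sym p)) (interval-unique lo s))
    (λ v∈ → ∈-interval⁻ (↭P.∈-resp-↭ p v∈))
    (λ v∈ → ↭P.∈-resp-↭ (↭-sym p) (∈-interval⁺ v∈))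

  arrangement⇒↭ : ∀ {lo s xs} → Arrangement lo (lo + s) xs → xs ↭ interval lo s
  arrangement⇒↭ {lo} {s} A = ∼bag⇒↭ (unique∧set⇒bag (unique A) (interval-unique lo s)
    (mk⇔ (λ v∈ → ∈-interval⁺ (sound A v∈)) (λ v∈ → complete A (∈-interval⁻ v∈))))

  ↭-interval-length : ∀ {lo s xs} → xs ↭ interval lo s → length xs ≡ s
  ↭-interval-length {lo} {s} p = trans (↭P.↭-length p) (ListP.length-applyUpTo (λ i → lo + i) s)

module Patterns where
  open import Data.Nat using (_+_)

  Below : ℕ → List ℕ → Set
  Below m xs = ∀ {x} → x ∈ xs → x < m

  -- α m β with m the maximum and every entry of α above every entry of β:
  -- the shape of a 132-avoiding permutation around its maximum
  record Separated (m : ℕ) (α β : List ℕ) : Set where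
    constructor separated
    field
      α<m : Below m α
      β<m : Below m β
      β<α : ∀ {x y} → x ∈ α → y ∈ β → y < x
  open Separated public

  No123At : ℕ → List ℕ → Set
  No123At a (b ∷ c ∷ _) = ¬ (a < b × b < c)
  No123At a _           = ⊤

  No123 : List ℕ → Set
  No123 []       = ⊤
  No123 (a ∷ xs) = No123At a xs × No123 xs

  No123⇒¬consecutive : ∀ π → No123 π → ¬ ContainsConsec123 π
  No123⇒¬consecutive π h (xs , ys , a , b , c , refl , a<b , b<c) = skip-prefix xs h
    where
    skip-prefix : ∀ xs → No123 (xs ++ a ∷ b ∷ c ∷ ys) → ⊥
    skip-prefix []       h = proj₁ h (a<b , b<c)
    skip-prefix (x ∷ xs) h = skip-prefix xs (proj₂ h)

  ¬consecutive⇒No123 : ∀ π → ¬ ContainsConsec123 π → No123 π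
  ¬consecutive⇒No123 []       h = tt
  ¬consecutive⇒No123 (a ∷ xs) h = head xs h , ¬consecutive⇒No123 xs shifted
    where
    head : ∀ xs → ¬ ContainsConsec123 (a ∷ xs) → No123At a xs
    head []          h = tt
    head (b ∷ [])    h = tt
    head (b ∷ c ∷ r) h (a<b , b<c) = h ([] , r , a , b , c , refl , a<b , b<c)
    shifted : ¬ ContainsConsec123 xs
    shifted (xs′ , ys , a′ , b′ , c′ , eq , p , q) =
      h (a ∷ xs′ , ys , a′ , b′ , c′ , cong (a ∷_) eq , p , q)

  NoFinalAscent : List ℕ → Set
  NoFinalAscent (a ∷ b ∷ [])    = ¬ (a < b)
  NoFinalAscent (a ∷ b ∷ c ∷ r) = NoFinalAscent (b ∷ c ∷ r)
  NoFinalAscent _               = ⊤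

  -- an occurrence of consecutive 123 in α m β (m maximal) lies inside α,
  -- inside β, or ends at m, in which case α ends with an ascent
  No123-around-max⁻ : ∀ m α β → Below m α → Below m β → No123 (α ++ m ∷ β) →
                      No123 α × NoFinalAscent α × No123 β
  No123-around-max⁻ m []              β α<m β<m (_ , h) = tt , tt , h
  No123-around-max⁻ m (a ∷ [])        β α<m β<m (_ , h) = (tt , tt) , tt , h .proj₂
  No123-around-max⁻ m (a ∷ b ∷ [])    β α<m β<m (wa , h) =
    (tt , tt , tt) , (λ a<b → wa (a<b , α<m (there (here refl)))) , h .proj₂ .proj₂
  No123-around-max⁻ m (a ∷ b ∷ c ∷ r) β α<m β<m (wa , h)
    with No123-around-max⁻ m (b ∷ c ∷ r) β (λ x∈ → α<m (there x∈)) β<m h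
  ... | hα , final , hβ = (wa , hα) , final , hβ

  No123-around-max⁺ : ∀ m α β → Below m α → Below m β →
                      No123 α → NoFinalAscent α → No123 β → No123 (α ++ m ∷ β)
  No123-around-max⁺ m [] β α<m β<m _ _ hβ = from-max β β<m , hβ
    where
    from-max : ∀ β → Below m β → No123At m β
    from-max []          _   = tt
    from-max (b ∷ [])    _   = tt
    from-max (b ∷ c ∷ _) β<m (m<b , _) = ℕP.<-asym m<b (β<m (here refl))
  No123-around-max⁺ m (a ∷ []) β α<m β<m _ _ hβ =
    before-max β β<m , No123-around-max⁺ m [] β (λ ()) β<m tt tt hβ
    where
    before-max : ∀ β → Below m β → No123At a (m ∷ β)
    before-max []      _   = tt
    before-max (b ∷ _) β<m (_ , m<b) = ℕP.<-asym m<b (β<m (here refl))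
  No123-around-max⁺ m (a ∷ b ∷ []) β α<m β<m (_ , hα) final hβ =
    (λ (a<b , _) → final a<b) ,
    No123-around-max⁺ m (b ∷ []) β (λ x∈ → α<m (there x∈)) β<m hα tt hβ
  No123-around-max⁺ m (a ∷ b ∷ c ∷ r) β α<m β<m (wa , hα) final hβ =
    wa , No123-around-max⁺ m (b ∷ c ∷ r) β (λ x∈ → α<m (there x∈)) β<m hα final hβ

  NoFinalAscent-skip : ∀ a ys m b zs →
    NoFinalAscent (a ∷ (ys ++ m ∷ b ∷ zs)) ≡ NoFinalAscent (ys ++ m ∷ b ∷ zs)
  NoFinalAscent-skip a []           m b zs = refl
  NoFinalAscent-skip a (y ∷ [])     m b zs = refl
  NoFinalAscent-skip a (y ∷ y′ ∷ _) m b zs = refl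

  NoFinalAscent-glue⁻ : ∀ m α β → NoFinalAscent (α ++ m ∷ β) → NoFinalAscent β
  NoFinalAscent-glue⁻ m []      []          h = tt
  NoFinalAscent-glue⁻ m []      (b ∷ [])    h = tt
  NoFinalAscent-glue⁻ m []      (b ∷ c ∷ r) h = h
  NoFinalAscent-glue⁻ m (a ∷ α) []          h = tt
  NoFinalAscent-glue⁻ m (a ∷ α) (b ∷ β)     h =
    NoFinalAscent-glue⁻ m α (b ∷ β) (subst (λ P → P) (NoFinalAscent-skip a α m b β) h)

  NoFinalAscent-glue⁺ : ∀ m α β → Below m β → β ≢ [] → NoFinalAscent β → NoFinalAscent (α ++ m ∷ β)
  NoFinalAscent-glue⁺ m α       []            β<m β≢[] h = ⊥-elim (β≢[] refl)
  NoFinalAscent-glue⁺ m []      (b ∷ [])      β<m β≢[] h = ℕP.<-asym (β<m (here refl))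
  NoFinalAscent-glue⁺ m []      (b ∷ c ∷ r)   β<m β≢[] h = h
  NoFinalAscent-glue⁺ m (a ∷ α) (b ∷ β)       β<m β≢[] h =
    subst (λ P → P) (sym (NoFinalAscent-skip a α m b β)) (NoFinalAscent-glue⁺ m α (b ∷ β) β<m β≢[] h)

  NoFinalAscent-max-last : ∀ m α → Below m α → NoFinalAscent (α ++ m ∷ []) → α ≡ []
  NoFinalAscent-max-last m []              α<m h = refl
  NoFinalAscent-max-last m (a ∷ [])        α<m h = ⊥-elim (h (α<m (here refl)))
  NoFinalAscent-max-last m (a ∷ b ∷ [])    α<m h
    with () ← NoFinalAscent-max-last m (b ∷ []) (λ x∈ → α<m (there x∈)) h
  NoFinalAscent-max-last m (a ∷ b ∷ c ∷ r) α<m h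
    with () ← NoFinalAscent-max-last m (b ∷ c ∷ r) (λ x∈ → α<m (there x∈)) h

  lead231 : ℕ → List ℕ → ℕ
  lead231 a (b ∷ c ∷ _) = if ⌊ c <? a ⌋ ∧ ⌊ a <? b ⌋ then 1 else 0
  lead231 a _           = 0

  occ231-∷ : ∀ a xs → occ231 (a ∷ xs) ≡ lead231 a xs + occ231 xs
  occ231-∷ a []          = refl
  occ231-∷ a (b ∷ [])    = refl
  occ231-∷ a (b ∷ c ∷ r) = refl

  lead231-no-ascent : ∀ {a b} c r → ¬ (a < b) → lead231 a (b ∷ c ∷ r) ≡ 0
  lead231-no-ascent {a} {b} c r a≮b with c <? a | a <? b
  ... | yes _ | yes a<b = ⊥-elim (a≮b a<b)
  ... | yes _ | no _    = refl
  ... | no _  | _       = refl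

  lead231-no-descent : ∀ {a c} b r → ¬ (c < a) → lead231 a (b ∷ c ∷ r) ≡ 0
  lead231-no-descent {a} {c} b r c≮a with c <? a
  ... | yes c<a = ⊥-elim (c≮a c<a)
  ... | no _    = refl

  lead231-occurrence : ∀ {a b c} r → c < a → a < b → lead231 a (b ∷ c ∷ r) ≡ 1
  lead231-occurrence {a} {b} {c} r c<a a<b with c <? a | a <? b
  ... | yes _ | yes _   = refl
  ... | yes _ | no a≮b  = ⊥-elim (a≮b a<b)
  ... | no c≮a | _      = ⊥-elim (c≮a c<a)

  -- the window (last of α) m (first of β) is a 231 exactly when both sides
  -- are nonempty
  junction : List ℕ → List ℕ → ℕ
  junction []      _       = 0
  junction (_ ∷ _) []      = 0
  junction (_ ∷ _) (_ ∷ _) = 1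

  junction-[]ʳ : ∀ α → junction α [] ≡ 0
  junction-[]ʳ []      = refl
  junction-[]ʳ (_ ∷ _) = refl

  junction-nonempty : ∀ {α β} → α ≢ [] → β ≢ [] → junction α β ≡ 1
  junction-nonempty {[]}    α≢[] _    = ⊥-elim (α≢[] refl)
  junction-nonempty {_ ∷ _} {[]} _ β≢[] = ⊥-elim (β≢[] refl)
  junction-nonempty {_ ∷ _} {_ ∷ _} _ _ = refl

  -- the 231's of α m β: those of α, those of β, and the one at the junction;
  -- the windows ending or starting at m are no 231's
  occ231-around-max : ∀ m α β → Separated m α β →
                      occ231 (α ++ m ∷ β) ≡ occ231 α + occ231 β + junction α β
  occ231-around-max m [] β sep =
    trans (occ231-∷ m β) (trans (cong (_+ occ231 β) (from-max β (β<m sep))) (sym (ℕP.+-identityʳ _)))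
    where
    from-max : ∀ β → Below m β → lead231 m β ≡ 0
    from-max []          _   = refl
    from-max (b ∷ [])    _   = refl
    from-max (b ∷ c ∷ r) β<m = lead231-no-ascent c r (ℕP.<-asym (β<m (here refl)))
  occ231-around-max m (a ∷ []) β sep =
    trans (occ231-∷ a (m ∷ β))
          (trans (cong₂ _+_ (across β (β<α sep (here refl)))
                            (occ231-around-max m [] β (separated (λ ()) (β<m sep) λ ())))
                 (rearrange (junction (a ∷ []) β) (occ231 β)))
    where
    across : ∀ β → (∀ {y} → y ∈ β → y < a) → lead231 a (m ∷ β) ≡ junction (a ∷ []) β
    across []      _   = refl
    across (b ∷ r) β<a = lead231-occurrence r (β<a (here refl)) (α<m sep (here refl))
    rearrange : ∀ x y → x + (0 + y + 0) ≡ 0 + y + x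
    rearrange x y = trans (cong (λ z → x + z) (ℕP.+-identityʳ y)) (ℕP.+-comm x y)
  occ231-around-max m (a ∷ b ∷ r) β sep =
    begin
      occ231 (a ∷ b ∷ r ++ m ∷ β)
        ≡⟨ occ231-∷ a (b ∷ r ++ m ∷ β) ⟩
      lead231 a (b ∷ r ++ m ∷ β) + occ231 (b ∷ r ++ m ∷ β)
        ≡⟨ cong₂ _+_ (inside r) (occ231-around-max m (b ∷ r) β
                       (separated (λ x∈ → α<m sep (there x∈)) (β<m sep) λ x∈ → β<α sep (there x∈))) ⟩
      lead231 a (b ∷ r) + (occ231 (b ∷ r) + occ231 β + junction (b ∷ r) β)
        ≡⟨ assoc (lead231 a (b ∷ r)) (occ231 (b ∷ r)) (occ231 β) (junction (b ∷ r) β) ⟩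
      lead231 a (b ∷ r) + occ231 (b ∷ r) + occ231 β + junction (b ∷ r) β
        ≡⟨ cong₂ (λ x y → x + occ231 β + y) (sym (occ231-∷ a (b ∷ r))) (same-junction β) ⟩
      occ231 (a ∷ b ∷ r) + occ231 β + junction (a ∷ b ∷ r) β
    ∎
    where
    open ≡-Reasoning
    inside : ∀ r → lead231 a (b ∷ r ++ m ∷ β) ≡ lead231 a (b ∷ r)
    inside []      = lead231-no-descent b β (ℕP.<-asym (α<m sep (here refl)))
    inside (c ∷ r) = refl
    same-junction : ∀ β → junction (b ∷ r) β ≡ junction (a ∷ b ∷ r) β
    same-junction []      = refl
    same-junction (_ ∷ _) = refl
    assoc : ∀ x y z u → x + (y + z + u) ≡ x + y + z + u
    assoc x y z u = trans (sym (ℕP.+-assoc x (y + z) u)) (cong (_+ u) (sym (ℕP.+-assoc x y z)))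

  ⊆-++-split : ∀ (xs : List ℕ) {ys us} → us ⊆ xs ++ ys →
               ∃₂ λ u₁ u₂ → us ≡ u₁ ++ u₂ × u₁ ⊆ xs × u₂ ⊆ ys
  ⊆-++-split []       p = [] , _ , refl , [] , p
  ⊆-++-split (x ∷ xs) (.x ∷ʳ p) with ⊆-++-split xs p
  ... | u₁ , u₂ , refl , p₁ , p₂ = u₁ , u₂ , refl , x ∷ʳ p₁ , p₂
  ⊆-++-split (x ∷ xs) (refl ∷ p) with ⊆-++-split xs p
  ... | u₁ , u₂ , refl , p₁ , p₂ = x ∷ u₁ , u₂ , refl , refl ∷ p₁ , p₂

  132-left : ∀ m α β → Contains132 α → Contains132 (α ++ m ∷ β)
  132-left m α β (a , b , c , p , a<c , c<b) = a , b , c , ⊆P.++⁺ʳ (m ∷ β) p , a<c , c<b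

  132-right : ∀ m α β → Contains132 β → Contains132 (α ++ m ∷ β)
  132-right m α β (a , b , c , p , a<c , c<b) = a , b , c , ⊆P.++⁺ˡ α (m ∷ʳ p) , a<c , c<b

  -- in a separated α m β every 132 lies inside α or inside β: an occurrence
  -- using m, or meeting both sides, would need a value of β above one of α
  132-around-max : ∀ m α β → Separated m α β → Contains132 (α ++ m ∷ β) → Contains132 α ⊎ Contains132 β
  132-around-max m α β sep (a , b , c , p , a<c , c<b) with ⊆-++-split α p
  ... | u₁ , u₂ , eq , p₁ , (.m ∷ʳ p₂) = without-max u₁ u₂ eq p₁ p₂
    where
    without-max : ∀ u₁ u₂ → a ∷ b ∷ c ∷ [] ≡ u₁ ++ u₂ → u₁ ⊆ α → u₂ ⊆ β →
                  Contains132 α ⊎ Contains132 β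
    without-max []                 _ refl p₁ p₂ = inj₂ (a , b , c , p₂ , a<c , c<b)
    without-max (_ ∷ [])           _ refl p₁ p₂ =
      ⊥-elim (ℕP.<-asym a<c (β<α sep (⊆-lookup p₁ (here refl)) (⊆-lookup p₂ (there (here refl)))))
    without-max (_ ∷ _ ∷ [])       _ refl p₁ p₂ =
      ⊥-elim (ℕP.<-asym a<c (β<α sep (⊆-lookup p₁ (here refl)) (⊆-lookup p₂ (here refl))))
    without-max (_ ∷ _ ∷ _ ∷ [])   [] refl p₁ p₂ = inj₁ (a , b , c , p₁ , a<c , c<b)
    without-max (_ ∷ _ ∷ _ ∷ [])   (_ ∷ _) () p₁ p₂
    without-max (_ ∷ _ ∷ _ ∷ _ ∷ _) _ () p₁ p₂
  ... | u₁ , u₂ , eq , p₁ , (refl ∷ p₂) = with-max u₁ _ eq p₁ p₂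
    where
    with-max : ∀ u₁ u₃ → a ∷ b ∷ c ∷ [] ≡ u₁ ++ m ∷ u₃ → u₁ ⊆ α → u₃ ⊆ β →
               Contains132 α ⊎ Contains132 β
    with-max []                 _ refl p₁ p₂ = ⊥-elim (ℕP.<-asym a<c (β<m sep (⊆-lookup p₂ (there (here refl)))))
    with-max (_ ∷ [])           _ refl p₁ p₂ =
      ⊥-elim (ℕP.<-asym a<c (β<α sep (⊆-lookup p₁ (here refl)) (⊆-lookup p₂ (here refl))))
    with-max (_ ∷ _ ∷ [])       _ refl p₁ p₂ =
      ⊥-elim (ℕP.<-asym c<b (α<m sep (⊆-lookup p₁ (there (here refl)))))
    with-max (_ ∷ _ ∷ _ ∷ [])   _ () p₁ p₂
    with-max (_ ∷ _ ∷ _ ∷ _ ∷ _) _ () p₁ p₂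

  avoid132⇒β<α : ∀ m α β → Below m β → (∀ {x} → x ∈ α → x ∉ β) → ¬ Contains132 (α ++ m ∷ β) →
                 ∀ {x y} → x ∈ α → y ∈ β → y < x
  avoid132⇒β<α m α β β<m disjoint avoid {x} {y} x∈α y∈β with ℕP.<-cmp x y
  ... | tri< x<y _ _ = ⊥-elim (avoid (x , m , y , ⊆P.++⁺ (from∈ x∈α) (refl ∷ from∈ y∈β) , x<y , β<m y∈β))
  ... | tri≈ _ refl _ = ⊥-elim (disjoint x∈α y∈β)
  ... | tri> _ _ y<x = y<x

module MaxDecomposition where
  open Arrangements
  open Patterns
  open import Data.Nat using (_+_)

  Unique-++⁻ : ∀ (xs : List ℕ) {ys} → Unique (xs ++ ys) →
               Unique xs × Unique ys × (∀ {v} → v ∈ xs → v ∉ ys)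
  Unique-++⁻ []       u = [] , u , λ ()
  Unique-++⁻ (x ∷ xs) (x∉ ∷ u) with Unique-++⁻ xs u
  ... | uxs , uys , disjoint = AllP.++⁻ˡ xs x∉ ∷ uxs , uys , λ where
    (here refl) v∈ys → All.lookup (AllP.++⁻ʳ xs x∉) v∈ys refl
    (there v∈)  v∈ys → disjoint v∈ v∈ys

  join-at-max : ∀ {lo b m α β} → lo ≤ b → b ≤ m → Arrangement b m α → Arrangement lo b β →
                Arrangement lo (suc m) (α ++ m ∷ β) × Separated m α β
  join-at-max {lo} {b} {m} {α} {β} lo≤b b≤m A B = arrangement U S C , sep
    where
    sep : Separated m α β
    sep = separated (λ x∈ → sound A x∈ .proj₂) (λ y∈ → ℕP.<-≤-trans (sound B y∈ .proj₂) b≤m)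
                    (λ x∈ y∈ → ℕP.<-≤-trans (sound B y∈ .proj₂) (sound A x∈ .proj₁))
    U : Unique (α ++ m ∷ β)
    U = UniqueP.++⁺ (unique A) (All.tabulate (λ y∈ m≡y → ℕP.<-irrefl (sym m≡y) (β<m sep y∈)) ∷ unique B)
          λ { (x∈ , here refl) → ℕP.<-irrefl refl (α<m sep x∈)
            ; (x∈ , there y∈)  → ℕP.<-irrefl refl (β<α sep x∈ y∈) }
    S : ∀ {v} → v ∈ α ++ m ∷ β → InRange lo (suc m) v
    S v∈ with ∈P.∈-++⁻ α v∈
    ... | inj₁ x∈          = ℕP.≤-trans lo≤b (sound A x∈ .proj₁) , ℕP.m<n⇒m<1+n (α<m sep x∈)
    ... | inj₂ (here refl) = ℕP.≤-trans lo≤b b≤m , ℕP.≤-refl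
    ... | inj₂ (there y∈)  = sound B y∈ .proj₁ , ℕP.m<n⇒m<1+n (β<m sep y∈)
    C : ∀ {v} → InRange lo (suc m) v → v ∈ α ++ m ∷ β
    C {v} (lo≤v , v≤m) with v <? b | ℕP.m≤n⇒m<n∨m≡n (ℕP.≤-pred v≤m)
    ... | yes v<b | _         = ∈P.∈-++⁺ʳ α (there (complete B (lo≤v , v<b)))
    ... | no v≮b  | inj₁ v<m  = ∈P.∈-++⁺ˡ (complete A (ℕP.≮⇒≥ v≮b , v<m))
    ... | no _    | inj₂ refl = ∈P.∈-++⁺ʳ α (here refl)

  around-max : ∀ {lo m α β} → Arrangement lo (suc m) (α ++ m ∷ β) →
               Below m α × Below m β × (∀ {x} → x ∈ α → x ∉ β)
  around-max {lo} {m} {α} {β} A with Unique-++⁻ α (unique A)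
  ... | _ , m∉β ∷ _ , disjoint =
      (λ x∈ → below (∈P.∈-++⁺ˡ x∈) λ { refl → disjoint x∈ (here refl) })
    , (λ y∈ → below (∈P.∈-++⁺ʳ α (there y∈)) λ { refl → All.lookup m∉β y∈ refl })
    , (λ x∈ y∈ → disjoint x∈ (there y∈))
    where
    below : ∀ {v} → v ∈ α ++ m ∷ β → v ≢ m → v < m
    below v∈ v≢m = ℕP.≤∧≢⇒< (ℕP.≤-pred (sound A v∈ .proj₂)) v≢m

  split-at-max : ∀ {lo m α β} → Arrangement lo (suc m) (α ++ m ∷ β) → Separated m α β →
                 lo ≤ min m α × min m α ≤ m × Arrangement (min m α) m α × Arrangement lo (min m α) β
  split-at-max {lo} {m} {α} {β} A sep with Unique-++⁻ α (unique A)
  ... | uα , _ ∷ uβ , _ = lo≤b , min≤⊤ m α , arrangement uα Sα Cα , arrangement uβ Sβ Cβ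
    where
    b = min m α
    b≤α : ∀ {x} → x ∈ α → b ≤ x
    b≤α = All.lookup (min≤xs m α)
    β<b : ∀ {y} → y ∈ β → y < b
    β<b y∈ = v<min⁺ (β<m sep y∈) (All.tabulate λ x∈ → β<α sep x∈ y∈)
    in-π : ∀ {v} → lo ≤ v → v < m → v ∈ α ++ m ∷ β
    in-π lo≤v v<m = complete A (lo≤v , ℕP.m<n⇒m<1+n v<m)
    lo≤b : lo ≤ b
    lo≤b with argmin-sel (λ x → x) m α
    ... | inj₁ b≡m = subst (lo ≤_) (sym b≡m) (sound A (∈P.∈-++⁺ʳ α (here refl)) .proj₁)
    ... | inj₂ b∈α = sound A (∈P.∈-++⁺ˡ b∈α) .proj₁
    Sα : ∀ {v} → v ∈ α → InRange b m v
    Sα x∈ = b≤α x∈ , α<m sep x∈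
    Cα : ∀ {v} → InRange b m v → v ∈ α
    Cα (b≤v , v<m) with ∈P.∈-++⁻ α (in-π (ℕP.≤-trans lo≤b b≤v) v<m)
    ... | inj₁ x∈          = x∈
    ... | inj₂ (here refl) = ⊥-elim (ℕP.<-irrefl refl v<m)
    ... | inj₂ (there y∈)  = ⊥-elim (ℕP.<⇒≱ (β<b y∈) b≤v)
    Sβ : ∀ {v} → v ∈ β → InRange lo b v
    Sβ y∈ = sound A (∈P.∈-++⁺ʳ α (there y∈)) .proj₁ , β<b y∈
    Cβ : ∀ {v} → InRange lo b v → v ∈ β
    Cβ (lo≤v , v<b) with ∈P.∈-++⁻ α (in-π lo≤v (ℕP.<-≤-trans v<b (min≤⊤ m α)))
    ... | inj₁ x∈          = ⊥-elim (ℕP.<⇒≱ v<b (b≤α x∈))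
    ... | inj₂ (here refl) = ⊥-elim (ℕP.<⇒≱ v<b (min≤⊤ m α))
    ... | inj₂ (there y∈)  = y∈

  split-point : ∀ {lo n b} → lo ≤ b → b ≤ lo + n → ∃ λ i → i ≤ n × b ≡ lo + (n ∸ i) × b + i ≡ lo + n
  split-point {lo} {n} {b} lo≤b b≤m = n ∸ j , ℕP.m∸n≤m n j , b≡ , top
    where
    j = b ∸ lo
    b≡lo+j : b ≡ lo + j
    b≡lo+j = sym (ℕP.m+[n∸m]≡n lo≤b)
    j≤n : j ≤ n
    j≤n = ℕP.+-cancelˡ-≤ lo j n (subst (_≤ lo + n) b≡lo+j b≤m)
    b≡ : b ≡ lo + (n ∸ (n ∸ j))
    b≡ = trans b≡lo+j (cong (λ i → lo + i) (sym (ℕP.m∸[m∸n]≡n j≤n)))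
    top : b + (n ∸ j) ≡ lo + n
    top = trans (cong (_+ (n ∸ j)) b≡lo+j)
                (trans (ℕP.+-assoc lo j (n ∸ j)) (cong (λ i → lo + i) (ℕP.m+[n∸m]≡n j≤n)))

  record Good (lo s k : ℕ) (π : List ℕ) : Set where
    constructor good
    field
      arranged : π ↭ interval lo s
      avoid132 : ¬ Contains132 π
      avoid123 : ¬ ContainsConsec123 π
      count231 : occ231 π ≡ k

  compose : ∀ {lo n i ka kb α β} → i ≤ n →
            Good (lo + (n ∸ i)) i ka α → NoFinalAscent α → Good lo (n ∸ i) kb β →
            Good lo (suc n) (ka + kb + junction α β) (α ++ (lo + n) ∷ β) × Separated (lo + n) α β
  compose {lo} {n} {i} {α = α} {β} i≤n (good pα α132 α123 refl) final (good pβ β132 β123 refl) =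
    good (arrangement⇒↭ Aπ) no132 no123 (occ231-around-max m α β sep) , sep
    where
    m = lo + n
    b = lo + (n ∸ i)
    top : b + i ≡ m
    top = trans (ℕP.+-assoc lo (n ∸ i) i) (cong (λ i → lo + i) (ℕP.m∸n+n≡m i≤n))
    joined = join-at-max (ℕP.m≤m+n lo (n ∸ i)) (subst (b ≤_) top (ℕP.m≤m+n b i))
                         (subst (λ z → Arrangement b z α) top (↭⇒arrangement pα)) (↭⇒arrangement pβ)
    sep = proj₂ joined
    Aπ : Arrangement lo (lo + suc n) (α ++ m ∷ β)
    Aπ = subst (λ z → Arrangement lo z (α ++ m ∷ β)) (sym (ℕP.+-suc lo n)) (proj₁ joined)
    no132 : ¬ Contains132 (α ++ m ∷ β)
    no132 c = [ α132 , β132 ]′ (132-around-max m α β sep c)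
    no123 : ¬ ContainsConsec123 (α ++ m ∷ β)
    no123 = No123⇒¬consecutive _ (No123-around-max⁺ m α β (α<m sep) (β<m sep)
              (¬consecutive⇒No123 α α123) final (¬consecutive⇒No123 β β123))

  record AroundMax (lo n k : ℕ) (α β : List ℕ) : Set where
    field
      i       : ℕ
      i≤n     : i ≤ n
      α-good  : Good (lo + (n ∸ i)) i (occ231 α) α
      α-final : NoFinalAscent α
      β-good  : Good lo (n ∸ i) (occ231 β) β
      weight  : k ≡ occ231 α + occ231 β + junction α β
      sep     : Separated (lo + n) α β

  decompose : ∀ {lo n k π} → Good lo (suc n) k π →
              ∃₂ λ α β → π ≡ α ++ (lo + n) ∷ β × AroundMax lo n k α β
  decompose {lo} {n} {k} {π} (good p π132 π123 refl) = α , β , π≡ , record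
    { i = i ; i≤n = i≤n
    ; α-good  = good (arrangement⇒↭ Aα) (λ c → π132 (subst Contains132 (sym π≡) (132-left m α β c)))
                     (No123⇒¬consecutive α (proj₁ no123)) refl
    ; α-final = proj₁ (proj₂ no123)
    ; β-good  = good (arrangement⇒↭ Aβ) (λ c → π132 (subst Contains132 (sym π≡) (132-right m α β c)))
                     (No123⇒¬consecutive β (proj₂ (proj₂ no123))) refl
    ; weight  = trans (cong occ231 π≡) (occ231-around-max m α β sep)
    ; sep     = sep }
    where
    m = lo + n
    Aπ : Arrangement lo (suc m) π
    Aπ = subst (λ z → Arrangement lo z π) (ℕP.+-suc lo n) (↭⇒arrangement p)
    split = ∈P.∈-∃++ (complete Aπ (ℕP.m≤m+n lo n , ℕP.≤-refl))
    α = proj₁ split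
    β = proj₁ (proj₂ split)
    π≡ : π ≡ α ++ m ∷ β
    π≡ = proj₂ (proj₂ split)
    A : Arrangement lo (suc m) (α ++ m ∷ β)
    A = subst (Arrangement lo (suc m)) π≡ Aπ
    shape = around-max A
    sep : Separated m α β
    sep = separated (proj₁ shape) (proj₁ (proj₂ shape))
            (avoid132⇒β<α m α β (proj₁ (proj₂ shape)) (proj₂ (proj₂ shape))
              (λ c → π132 (subst Contains132 (sym π≡) c)))
    parts = split-at-max A sep
    sizes = split-point (proj₁ parts) (proj₁ (proj₂ parts))
    i = proj₁ sizes
    i≤n = proj₁ (proj₂ sizes)
    b≡ = proj₁ (proj₂ (proj₂ sizes))
    top = proj₂ (proj₂ (proj₂ sizes))
    Aα : Arrangement (lo + (n ∸ i)) (lo + (n ∸ i) + i) α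
    Aα = subst₂ (λ a z → Arrangement a z α) b≡ (trans (sym top) (cong (_+ i) b≡)) (proj₁ (proj₂ (proj₂ parts)))
    Aβ : Arrangement lo (lo + (n ∸ i)) β
    Aβ = subst (λ z → Arrangement lo z β) b≡ (proj₂ (proj₂ (proj₂ parts)))
    no123 = No123-around-max⁻ m α β (α<m sep) (β<m sep)
              (¬consecutive⇒No123 _ (subst (λ z → ¬ ContainsConsec123 z) π≡ π123))

module Counting (S G : PS) (quadratic : S ⋆ S ≐ Disc)
                (linear : mono (+ 2) 2 1 ⋆ G ≐ 𝟙 ⊖ 𝕩 ⊖ S) where
  open PowerSeries
  open Equations S G quadratic linear
  open Arrangements
  open Patterns
  open MaxDecomposition
  open Enumeration
  open import Data.Nat using (_+_)

  -- the good permutations not ending with an ascent, to be counted by N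
  GoodN : ℕ → ℕ → ℕ → List ℕ → Set
  GoodN lo s k π = Good lo s k π × NoFinalAscent π

  Nonempty : (ℕ → ℕ → ℕ → List ℕ → Set) → ℕ → ℕ → ℕ → List ℕ → Set
  Nonempty E lo s k π = E lo s k π × π ≢ []

  good-length : ∀ {lo s k π} → Good lo s k π → length π ≡ s
  good-length g = ↭-interval-length (Good.arranged g)

  good-nonempty : ∀ {lo t k π} → Good lo (suc t) k π → π ≢ []
  good-nonempty g refl with () ← good-length g

  good-size-0 : ∀ {lo k π} → Good lo 0 k π ⇔ (π ≡ [] × k ≡ 0)
  good-size-0 {lo} = mk⇔ to (λ { (refl , refl) → good ↭-refl no132 (No123⇒¬consecutive [] tt) refl })
    where
    to : ∀ {k π} → Good lo 0 k π → π ≡ [] × k ≡ 0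
    to {π = []}    g = refl , sym (Good.count231 g)
    to {π = _ ∷ _} g with () ← good-length g
    no132 : ¬ Contains132 []
    no132 (_ , _ , _ , () , _)

  Pair : Set
  Pair = List ℕ × List ℕ

  glue : ℕ → Pair → List ℕ
  glue m (α , β) = α ++ m ∷ β

  glue-injective : ∀ m {α α′ β β′} → m ∉ α → m ∉ α′ →
                   glue m (α , β) ≡ glue m (α′ , β′) → (α , β) ≡ (α′ , β′)
  glue-injective m {[]}    {[]}     _   _    refl = refl
  glue-injective m {[]}    {_ ∷ _}  _   m∉α′ refl = ⊥-elim (m∉α′ (here refl))
  glue-injective m {_ ∷ _} {[]}     m∉α _    refl = ⊥-elim (m∉α (here refl))
  glue-injective m {a ∷ α} {a′ ∷ α′} m∉α m∉α′ eq with ListP.∷-injective eq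
  ... | refl , eq′ with glue-injective m (λ x∈ → m∉α (there x∈)) (λ x∈ → m∉α′ (there x∈)) eq′
  ...   | refl = refl

  enum-glue : ∀ m {Pairs : Pair → Set} {Class : List ℕ → Set} {c} →
              (∀ {x} → Pairs x → Class (glue m x) × Below m (proj₁ x)) →
              (∀ {π} → Class π → ∃ λ x → Pairs x × π ≡ glue m x) →
              Enumeration Pairs c → Enumeration Class c
  enum-glue m sound complete E = enum-resp
    (λ π → mk⇔ (λ { (x , p , refl) → proj₁ (sound p) }) complete) refl
    (enum-image (glue m) (λ p q → glue-injective m (below⇒∉ (proj₂ (sound p))) (below⇒∉ (proj₂ (sound q)))) E)
    where
    below⇒∉ : ∀ {α} → Below m α → m ∉ α
    below⇒∉ α<m m∈α = ℕP.<-irrefl refl (α<m m∈α)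

  -- the three shapes of α m β: α empty, β empty, or neither, in which
  -- case the junction contributes one 231 besides those of α and β
  MaxFirst : (List ℕ → Set) → Pair → Set
  MaxFirst Q (α , β) = α ≡ [] × Q β

  MaxLast : (List ℕ → Set) → Pair → Set
  MaxLast Q (α , β) = β ≡ [] × Q α

  Inner : (ℕ → ℕ → ℕ → List ℕ → Set) → ℕ → ℕ → ℕ → Pair → Set
  Inner E lo n zero    _       = ⊥
  Inner E lo n (suc k) (α , β) =
    ∃ λ i → i ≤ n × ∃ λ j → j ≤ k × Nonempty GoodN (lo + (n ∸ i)) i j α × Nonempty E lo (n ∸ i) (k ∸ j) β

  enum-first : ∀ {Q c} → Enumeration Q c → Enumeration (MaxFirst Q) c
  enum-first E = enum-resp (λ (α , β) → mk⇔ (λ { (β , q , refl) → refl , q }) λ { (refl , q) → β , q , refl })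
                           refl (enum-image ([] ,_) (λ _ _ → cong proj₂) E)

  enum-last : ∀ {Q c} → Enumeration Q c → Enumeration (MaxLast Q) c
  enum-last E = enum-resp (λ (α , β) → mk⇔ (λ { (α , q , refl) → refl , q }) λ { (refl , q) → α , q , refl })
                          refl (enum-image (_, []) (λ _ _ → cong proj₁) E)

  enum-inner : ∀ {E : ℕ → ℕ → ℕ → List ℕ → Set} (C : PS) lo n k →
               (∀ i j → i ≤ n → Enumeration (Nonempty GoodN (lo + (n ∸ i)) i j) ((N ⊖ unit) i j)) →
               (∀ i j → i ≤ n → Enumeration (Nonempty E lo i j) ((C ⊖ unit) i j)) →
               Enumeration (Inner E lo n k) ((t· ((N ⊖ unit) ⋆ (C ⊖ unit))) n k)
  enum-inner C lo n zero    EA EB = enum-∅ λ _ ()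
  enum-inner C lo n (suc k) EA EB = enum-⋆ (N ⊖ unit) (C ⊖ unit) n k determined
    (λ i j i≤n _ → EA i j i≤n) (λ i j i≤n _ → EB i j i≤n)
    where
    -- the size and the number of 231's of α are read off α itself
    determined : ∀ {i j i′ j′ α} → Nonempty GoodN (lo + (n ∸ i)) i j α →
                 Nonempty GoodN (lo + (n ∸ i′)) i′ j′ α → i ≡ i′ × j ≡ j′
    determined ((g , _) , _) ((g′ , _) , _) =
      trans (sym (good-length g)) (good-length g′) , trans (sym (Good.count231 g)) (Good.count231 g′)

  enum-pos : ∀ {E : ℕ → ℕ → ℕ → List ℕ → Set} (C : PS) →
             (∀ {lo s k π} → E lo s k π → Good lo s k π) → (∀ k → C 0 k ≡ unit 0 k) →
             ∀ {lo} t k → Enumeration (E lo t k) (C t k) → Enumeration (Nonempty E lo t k) ((C ⊖ unit) t k)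
  enum-pos C forget C-start zero k _ =
    enum-resp (λ _ → mk⇔ (λ ()) λ (e , π≢[]) → π≢[] (proj₁ (Equivalence.to good-size-0 (forget e))))
              (sym (trans (cong (ℤ._- unit 0 k) (C-start k)) (ℤP.+-inverseʳ (unit 0 k))))
              (enum-∅ λ _ ())
  enum-pos C forget C-start (suc t) k E =
    enum-resp (λ π → mk⇔ (λ e → e , good-nonempty (forget e)) proj₁) (sym (ℤP.+-identityʳ (C (suc t) k))) E

  reindex : ∀ {lo lo′ s s′ k k′ π} → lo ≡ lo′ → s ≡ s′ → k ≡ k′ →
            Good lo s k π → Good lo′ s′ k′ π
  reindex refl refl refl g = g

  good-[] : ∀ {lo} → Good lo 0 0 []
  good-[] = Equivalence.from good-size-0 (refl , refl)

  inner-nonempty : ∀ {E lo n k α β} → Inner E lo n k (α , β) → α ≢ [] × β ≢ []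
  inner-nonempty {k = suc k} (_ , _ , _ , _ , (_ , α≢[]) , (_ , β≢[])) = α≢[] , β≢[]

  inner-right : ∀ {E lo n k α β} → Inner E lo n k (α , β) → ∃₂ λ s j → E lo s j β
  inner-right {k = suc k} (i , _ , j , _ , _ , (e , _)) = _ , _ , e

  classify : ∀ {lo n k α β} → AroundMax lo n k α β →
             MaxFirst (Good lo n k) (α , β) ⊎ (MaxLast (Nonempty GoodN lo n k) (α , β) ⊎ Inner Good lo n k (α , β))
  classify {lo} {n} {k} {[]} {β} d =
    inj₁ (refl , reindex refl (cong (n ∸_) (sym (good-length α-good))) (sym (trans weight (ℕP.+-identityʳ _))) β-good)
    where open AroundMax d
  classify {lo} {n} {k} {a ∷ α} {[]} d = inj₂ (inj₁ (refl , (α-good′ , α-final) , λ ()))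
    where
    open AroundMax d
    n∸i≡0 : n ∸ i ≡ 0
    n∸i≡0 = sym (good-length β-good)
    α-good′ : Good lo n k (a ∷ α)
    α-good′ = reindex (trans (cong (λ z → lo + z) n∸i≡0) (ℕP.+-identityʳ lo))
                      (ℕP.≤-antisym i≤n (ℕP.m∸n≡0⇒m≤n n∸i≡0))
                      (sym (trans weight (trans (ℕP.+-identityʳ _) (ℕP.+-identityʳ _)))) α-good
  classify {lo} {n} {k} {a ∷ α} {b ∷ β} d =
    inj₂ (inj₂ (subst (λ k → Inner Good lo n k (a ∷ α , b ∷ β)) (sym (trans weight (ℕP.+-comm _ 1)))
      (i , i≤n , occ231 (a ∷ α) , ℕP.m≤m+n _ _ , ((α-good , α-final) , λ ()) ,
       (reindex refl refl (sym (ℕP.m+n∸m≡n (occ231 (a ∷ α)) _)) β-good , λ ()))))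
    where open AroundMax d

  first-sound : ∀ {lo n k β} → Good lo n k β → Good lo (suc n) k ((lo + n) ∷ β) × Separated (lo + n) [] β
  first-sound {k = k} g with compose {i = 0} z≤n good-[] tt g
  ... | g′ , sep = reindex refl refl (ℕP.+-identityʳ k) g′ , sep

  last-sound : ∀ {lo n k α} → Nonempty GoodN lo n k α →
               Good lo (suc n) k (α ++ (lo + n) ∷ []) × Separated (lo + n) α []
  last-sound {lo} {n} {k} {α} ((g , final) , _) =
    let g′ , sep = compose ℕP.≤-refl (reindex bottom refl refl g) final (reindex refl n∸n≡0 refl good-[])
    in reindex refl refl weight g′ , sep
    where
    n∸n≡0 : 0 ≡ n ∸ n
    n∸n≡0 = sym (ℕP.n∸n≡0 n)
    bottom : lo ≡ lo + (n ∸ n)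
    bottom = trans (sym (ℕP.+-identityʳ lo)) (cong (λ z → lo + z) n∸n≡0)
    weight : k + 0 + junction α [] ≡ k
    weight = trans (cong₂ _+_ (ℕP.+-identityʳ k) (junction-[]ʳ α)) (ℕP.+-identityʳ k)

  inner-sound : ∀ {E lo n k α β} → (∀ {lo s k π} → E lo s k π → Good lo s k π) → Inner E lo n k (α , β) →
                Good lo (suc n) k (α ++ (lo + n) ∷ β) × Separated (lo + n) α β
  inner-sound {k = suc k} {α} {β} forget (i , i≤n , j , j≤k , ((gα , final) , α≢[]) , (eβ , β≢[])) =
    let g , sep = compose i≤n gα final (forget eβ) in reindex refl refl weight g , sep
    where
    weight : j + (k ∸ j) + junction α β ≡ suc k
    weight = trans (cong₂ _+_ (ℕP.m+[n∸m]≡n j≤k) (junction-nonempty α≢[] β≢[])) (ℕP.+-comm k 1)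

  FPairs NPairs : ℕ → ℕ → ℕ → Pair → Set
  FPairs lo n k x = MaxFirst (Good lo n k) x ⊎ (MaxLast (Nonempty GoodN lo n k) x ⊎ Inner Good lo n k x)
  NPairs lo n k x = MaxFirst (GoodN lo n k) x ⊎ Inner GoodN lo n k x

  FPairs-sound : ∀ {lo n k x} → FPairs lo n k x → Good lo (suc n) k (glue (lo + n) x) × Below (lo + n) (proj₁ x)
  FPairs-sound (inj₁ (refl , g))        = proj₁ (first-sound g) , λ ()
  FPairs-sound (inj₂ (inj₁ (refl , p))) = let g , sep = last-sound p in g , α<m sep
  FPairs-sound (inj₂ (inj₂ p))          = let g , sep = inner-sound (λ g → g) p in g , α<m sep

  FPairs-complete : ∀ {lo n k π} → Good lo (suc n) k π → ∃ λ x → FPairs lo n k x × π ≡ glue (lo + n) x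
  FPairs-complete g with decompose g
  ... | α , β , π≡ , d = (α , β) , classify d , π≡

  NPairs-sound : ∀ {lo n k x} → NPairs lo n k x → GoodN lo (suc n) k (glue (lo + n) x) × Below (lo + n) (proj₁ x)
  NPairs-sound {lo} {n} {x = [] , β} (inj₁ (refl , g , final)) with first-sound g
  ... | g′ , sep = (g′ , max-first β (β<m sep) final) , λ ()
    where
    max-first : ∀ β → Below (lo + n) β → NoFinalAscent β → NoFinalAscent ((lo + n) ∷ β)
    max-first []      _   _     = tt
    max-first (b ∷ β) β<m final = NoFinalAscent-glue⁺ (lo + n) [] (b ∷ β) β<m (λ ()) final
  NPairs-sound {lo} {n} {x = α , β} (inj₂ p) with inner-sound proj₁ p | inner-right p | inner-nonempty p
  ... | g , sep | _ , _ , (_ , final) | _ , β≢[] =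
    (g , NoFinalAscent-glue⁺ (lo + n) α β (β<m sep) β≢[] final) , α<m sep

  NPairs-complete : ∀ {lo n k π} → GoodN lo (suc n) k π → ∃ λ x → NPairs lo n k x × π ≡ glue (lo + n) x
  NPairs-complete {lo} {n} (g , final) with decompose g
  ... | α , β , refl , d with classify d
  ...   | inj₁ (refl , gβ) = ([] , β) , inj₁ (refl , gβ , NoFinalAscent-glue⁻ (lo + n) [] β final) , refl
  ...   | inj₂ (inj₁ (refl , (_ , α≢[]))) =
          ⊥-elim (α≢[] (NoFinalAscent-max-last (lo + n) α (α<m (AroundMax.sep d)) final))
  ...   | inj₂ (inj₂ p) = (α , β) , inj₂ (upgrade p) , refl
    where
    upgrade : ∀ {k} → Inner Good lo n k (α , β) → Inner GoodN lo n k (α , β)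
    upgrade {suc k} (i , i≤n , j , j≤k , pα , (gβ , β≢[])) =
      i , i≤n , j , j≤k , pα , ((gβ , NoFinalAscent-glue⁻ (lo + n) α β final) , β≢[])

  Counts : ℕ → Set
  Counts t = (∀ lo k → Enumeration (Good lo t k) (F t k)) × (∀ lo k → Enumeration (GoodN lo t k) (N t k))

  counts-0 : Counts 0
  counts-0 = (λ lo k → subst (Enumeration _) (sym (F-start k)) (size-0 k λ π → good-size-0))
           , (λ lo k → subst (Enumeration _) (sym (N-start k)) (size-0 k λ π → nfa-size-0))
    where
    open Equivalence using (to; from)
    size-0 : ∀ {P : List ℕ → Set} k → (∀ π → P π ⇔ (π ≡ [] × k ≡ 0)) → Enumeration P (unit 0 k)
    size-0 zero    P⇔ =
      enum-single [] λ π → mk⇔ (λ p → proj₁ (to (P⇔ π) p)) (λ π≡ → from (P⇔ π) (π≡ , refl))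
    size-0 (suc k) P⇔ = enum-∅ λ π p → case proj₂ (to (P⇔ π) p) of λ ()
    nfa-size-0 : ∀ {lo k π} → GoodN lo 0 k π ⇔ (π ≡ [] × k ≡ 0)
    nfa-size-0 = mk⇔ (λ (g , _) → to good-size-0 g) λ { (refl , refl) → from good-size-0 (refl , refl) , tt }

  counts-suc : ∀ n → (∀ t → t ≤ n → Counts t) → Counts (suc n)
  counts-suc n below = F-count , N-count
    where
    pos-N : ∀ lo i j → i ≤ n → Enumeration (Nonempty GoodN lo i j) ((N ⊖ unit) i j)
    pos-N lo i j i≤n = enum-pos N proj₁ N-start i j (proj₂ (below i i≤n) lo j)
    pos-F : ∀ lo i j → i ≤ n → Enumeration (Nonempty Good lo i j) ((F ⊖ unit) i j)
    pos-F lo i j i≤n = enum-pos F (λ g → g) F-start i j (proj₁ (below i i≤n) lo j)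
    -- the left side of an inner pair takes the top i values below lo + n
    inner-α : ∀ lo i j → i ≤ n → Enumeration (Nonempty GoodN (lo + (n ∸ i)) i j) ((N ⊖ unit) i j)
    inner-α lo i j = pos-N (lo + (n ∸ i)) i j

    F-count : ∀ lo k → Enumeration (Good lo (suc n) k) (F (suc n) k)
    F-count lo k = enum-glue (lo + n) FPairs-sound FPairs-complete
      (subst (Enumeration _) (sym (trans (F-recurrence n k) (ℤP.+-assoc (F n k) _ _)))
        (enum-⊎ (enum-first (proj₁ (below n ℕP.≤-refl) lo k))
                (enum-⊎ (enum-last (pos-N lo n k ℕP.≤-refl)) (enum-inner F lo n k (inner-α lo) (pos-F lo))
                        λ { (refl , _) inner → proj₂ (inner-nonempty inner) refl })
                λ { (refl , _) (inj₁ (_ , (_ , α≢[]))) → α≢[] refl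
                  ; (refl , _) (inj₂ inner) → proj₁ (inner-nonempty inner) refl }))

    N-count : ∀ lo k → Enumeration (GoodN lo (suc n) k) (N (suc n) k)
    N-count lo k = enum-glue (lo + n) NPairs-sound NPairs-complete
      (subst (Enumeration _) (sym (N-recurrence n k))
        (enum-⊎ (enum-first (proj₂ (below n ℕP.≤-refl) lo k)) (enum-inner N lo n k (inner-α lo) (pos-N lo))
                λ { (refl , _) inner → proj₁ (inner-nonempty inner) refl }))

  counts : ∀ n → Counts n
  counts = <-rec Counts λ where
    zero    _       → counts-0
    (suc n) smaller → counts-suc n λ t t≤n → smaller (s≤s t≤n)

open MaxDecomposition using (Good; good)
open Enumeration using (Enumeration; enumeration)

enumeration⇒HasCount : ∀ {n k c} → Enumeration (Good 0 n k) c → HasCount n k c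
enumeration⇒HasCount (enumeration L distinct exact count) =
  L , distinct , (λ π → mk⇔ (λ π∈ → let good p a b o = to (exact π) π∈ in (p , a , b) , o)
                            (λ ((p , a , b) , o) → from (exact π) (good p a b o))) , count
  where open Equivalence

-- The theorem: F = 1 + G(x + x²G) counts the good permutations of [0, n).
mainTheorem16 : (S G : PS)
    → S 0 0 ≡ 1ℤ
    → (S ⋆ S) ≗ₚ Disc
    → (mono (+ 2) 2 1 ⋆ G) ≗ₚ (𝟙 ⊖ 𝕩 ⊖ S)
    → ∀ (n k : ℕ) → HasCount n k ((𝟙 ⊕ G ⋆ (𝕩 ⊕ mono 1ℤ 2 0 ⋆ G)) n k)
mainTheorem16 S G _ quadratic linear n k =
  enumeration⇒HasCount (proj₁ (counts n) 0 k)
  where open Counting S G (coeffwise quadratic) (coeffwise linear)
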